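{- Let $\Gamma$ be a reduced graph and $\pi_1,\pi_2\in\mathrm{Aut}^{\pi}(\Gamma)$. Then $$\alpha(\pi_1)=\alpha(\pi_2) \iff \mathrm{Aut}(\Gamma)\pi_1 = \mathrm{Aut}(\Gamma)\pi_2,$$ and consequently $|\mathrm{Im}(\alpha)| = |\mathrm{Aut}^{\pi}(\Gamma)|/|\mathrm{Aut}(\Gamma)|$. Moreover, if $\Gamma$ is connected and nonbipartite, then $|\mathrm{Im}(\alpha)|$ equals the instability index $\mathrm{Inst}(\Gamma)$.
   Context: Graphs are finite, simple, loopless; $N(v)$ is the neighbourhood of $v$; reduced means $N(v)=N(w)\Rightarrow v=w$. $\mathrm{Aut}^{\pi}(\Gamma)$ is the group of bijections $\pi$ of $V$ such that every $\pi(N(v))$ is equal to $N(w)$ for some $w$; $\gamma(\pi)$ is the permutation with $N(\gamma(\pi)(v))=\pi(N(v))$. The map $\alpha:\mathrm{Aut}^{\pi}(\Gamma)\to\mathrm{Aut}^{\pi}(\Gamma)$ is $\alpha(\pi)=\pi^{ -1}\circ\gamma(\pi)$. The canonical double cover $\mathrm{B}\Gamma=\Gamma\times K_2$ has vertex set $V\times\{0,1\}$, $(u,i)\sim(v,j)$ iff $(u,v)\in E$ and $i\neq j$; $\mathrm{Inst}(\Gamma)=|\mathrm{Aut}(\mathrm{B}\Gamma)|/(2|\mathrm{Aut}(\Gamma)|)$. -}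

module Defs where

open import Data.Bool using (Bool; true; false)
open import Data.Nat using (ℕ)
open import Data.Fin using (Fin)
open import Data.Product using (Σ; ∃; _×_; _,_; proj₁)
open import Data.Empty using (⊥)
open import Relation.Nullary using (¬_)
open import Relation.Binary.PropositionalEquality using (_≡_; _≢_)
open import Function using (_∘_)
open import Function.Bundles using (_↔_; Inverse; _⇔_)

record Graph (V : Set) : Set where
  field
    adj      : V → V → Bool
    adj-sym  : ∀ u v → adj u v ≡ adj v u
    loopless : ∀ v → adj v v ≡ false
open Graph public

Perm : Set → Set
Perm A = A ↔ A

module _ {V : Set} where
  ap : Perm V → V → V
  ap π = Inverse.to π

  ap⁻¹ : Perm V → V → V
  ap⁻¹ π = Inverse.from π

  _≈ₚ_ : Perm V → Perm V → Set
  σ ≈ₚ τ = ∀ x → ap σ x ≡ ap τ x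

  _∈N_ : V → V → Graph V → Set
  (x ∈N v) Γ = adj Γ v x ≡ true

  SameN : Graph V → V → V → Set
  SameN Γ v w = ∀ x → (x ∈N v) Γ ⇔ (x ∈N w) Γ

  Reduced : Graph V → Set
  Reduced Γ = ∀ v w → SameN Γ v w → v ≡ w

  ImageNbhdEq : Graph V → Perm V → V → V → Set
  ImageNbhdEq Γ π v w = ∀ x → (∃ λ u → (u ∈N v) Γ × ap π u ≡ x) ⇔ (x ∈N w) Γ

  InAutπ : Graph V → Perm V → Set
  InAutπ Γ π = ∀ v → ∃ λ w → ImageNbhdEq Γ π v w

  -- γ(π): N(γ(π)(v)) = π(N(v)); read off from the membership witness
  -- (unique when Γ is reduced).
  γ : (Γ : Graph V) (π : Perm V) → InAutπ Γ π → V → V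
  γ Γ π h v = proj₁ (h v)

  α : (Γ : Graph V) (π : Perm V) → InAutπ Γ π → V → V
  α Γ π h = ap⁻¹ π ∘ γ Γ π h

  IsAut : Graph V → Perm V → Set
  IsAut Γ σ = ∀ u v → adj Γ (ap σ u) (ap σ v) ≡ adj Γ u v

  InRightCoset : Graph V → Perm V → Perm V → Set
  InRightCoset Γ π ρ = ∃ λ σ → IsAut Γ σ × (∀ x → ap ρ x ≡ ap σ (ap π x))

  SameRightCoset : Graph V → Perm V → Perm V → Set
  SameRightCoset Γ π₁ π₂ = ∀ ρ → InRightCoset Γ π₁ ρ ⇔ InRightCoset Γ π₂ ρ

  InImα : Graph V → (V → V) → Set
  InImα Γ f = ∃ λ π → Σ (InAutπ Γ π) λ h → ∀ v → f v ≡ α Γ π h v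

  data Walk (Γ : Graph V) : V → V → Set where
    here : ∀ {v} → Walk Γ v v
    step : ∀ {u v w} → adj Γ u v ≡ true → Walk Γ v w → Walk Γ u w

  Connected : Graph V → Set
  Connected Γ = ∀ u v → Walk Γ u v

  Bipartite : Graph V → Set
  Bipartite Γ = ∃ λ (c : V → Bool) → ∀ u v → adj Γ u v ≡ true → c u ≢ c v

  NonBipartite : Graph V → Set
  NonBipartite Γ = ¬ Bipartite Γ

-- The set {t : T | P t}, counted up to the equivalence _≈_, has exactly k
-- elements: an enumeration by Fin k that lands in P, is injective up to ≈,
-- and hits every element of P up to ≈.
HasCard : {T : Set} → (T → T → Set) → (T → Set) → ℕ → Set
HasCard {T} _≈_ P k =
  Σ (Fin k → T) λ e →
    (∀ i → P (e i)) × (∀ i j → e i ≈ e j → i ≡ j) × (∀ t → P t → ∃ λ i → t ≈ e i)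

-- canonical double cover BΓ = Γ × K₂ on V × Bool
xorB : Bool → Bool → Bool
xorB true  true  = false
xorB true  false = true
xorB false true  = true
xorB false false = false

andB : Bool → Bool → Bool
andB true b = b
andB false _ = false

open import Relation.Binary.PropositionalEquality using (refl; cong₂)

private
  xor-sym : ∀ a b → xorB a b ≡ xorB b a
  xor-sym true true = refl
  xor-sym true false = refl
  xor-sym false true = refl
  xor-sym false false = refl

  and-false : ∀ a → andB a false ≡ false
  and-false true = refl
  and-false false = refl

  xor-self : ∀ a → xorB a a ≡ false
  xor-self true = refl
  xor-self false = refl

B : {V : Set} → Graph V → Graph (V × Bool)
B Γ = record
  { adj      = λ { (u , i) (v , j) → andB (adj Γ u v) (xorB i j) }
  ; adj-sym  = λ { (u , i) (v , j) → cong₂ andB (adj-sym Γ u v) (xor-sym i j) }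
  ; loopless = λ { (u , i) → lemma (adj Γ u u) (xorB i i) (loopless Γ u) }
  }
  where
  lemma : ∀ a b → a ≡ false → andB a b ≡ false
  lemma .false b refl = refl

-- For reduced Γ, π ∈ Aut^π(Γ) says exactly that (γ(π), π) is a two-fold automorphism
-- (u ∼ v ⇔ γ(π)u ∼ πv), and reducedness makes γ(π) unique, hence injective, hence a permutation
-- of the finite vertex set. Composing with σ ∈ Aut(Γ) turns the pair into (σγ(π), σπ), which
-- leaves α(π) = π⁻¹γ(π) unchanged; conversely α(ρ) = α(π) says that ρπ⁻¹ carries γ(π)v to γ(ρ)v,
-- and the two-fold identities of π and ρ then make ρπ⁻¹ an automorphism. So α is a complete
-- invariant of the right cosets of Aut(Γ), and representatives of Im α composed with Aut(Γ)
-- enumerate Aut^π(Γ). If Γ is connected and nonbipartite, BΓ is connected and bipartite with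
-- colour classes V × {0} and V × {1}, so an automorphism of BΓ preserves or swaps them; up to the
-- swap it acts layerwise by a two-fold automorphism (γ(π), π), whence |Aut(BΓ)| = 2 |Aut^π(Γ)|.

module Submission where

open import Defs
open import Data.Bool using (Bool; true; false; not)
open import Data.Bool.Properties using (not-involutive; not-¬; ¬-not; ⇔→≡)
open import Data.Empty using (⊥-elim)
open import Data.Fin using (Fin; zero; suc)
open import Data.Fin.Properties using (_≟_; any?; injective⇒≤; cantor-schröder-bernstein; *↔×; 2↔Bool)
open import Data.Nat using (ℕ; zero; suc; _*_)
open import Data.Nat.Properties using (1+n≰n; *-assoc; *-comm)
open import Data.Product using (Σ; ∃; _×_; _,_; proj₁; proj₂)
open import Data.Product.Function.NonDependent.Propositional using (_×-↔_)
open import Function using (_∘_)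
open import Function.Bundles using (_↔_; _⇔_; Inverse; Injection; Equivalence; mk⇔; mk↔ₛ′)
open import Function.Properties.Inverse using (↔-refl; ↔-sym; ↔-trans; ↔⇒↣)
open import Function.Properties.Equivalence using () renaming (sym to ⇔-sym; trans to ⇔-trans)
open import Relation.Binary.PropositionalEquality
open import Relation.Nullary using (yes; no)

open ≡-Reasoning

andB-trueʳ : ∀ a → andB a true ≡ a
andB-trueʳ true  = refl
andB-trueʳ false = refl

andB-falseʳ : ∀ a → andB a false ≡ false
andB-falseʳ true  = refl
andB-falseʳ false = refl

andB≡true⇒ʳ : ∀ a b → andB a b ≡ true → b ≡ true
andB≡true⇒ʳ true  b eq = eq
andB≡true⇒ʳ false b ()

xorB≡true⇒not : ∀ a b → xorB a b ≡ true → b ≡ not a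
xorB≡true⇒not true  false _ = refl
xorB≡true⇒not false true  _ = refl

xorB-not : ∀ a → xorB a (not a) ≡ true
xorB-not true  = refl
xorB-not false = refl

xorB-falseʳ : ∀ a → xorB a false ≡ a
xorB-falseʳ true  = refl
xorB-falseʳ false = refl

xorB-trueʳ : ∀ a → xorB a true ≡ not a
xorB-trueʳ true  = refl
xorB-trueʳ false = refl

xorB-involutive : ∀ s i → xorB s (xorB s i) ≡ i
xorB-involutive true  true  = refl
xorB-involutive true  false = refl
xorB-involutive false true  = refl
xorB-involutive false false = refl

xorB-injective : ∀ s {i j} → xorB s i ≡ xorB s j → i ≡ j
xorB-injective s {i} {j} eq =
  trans (sym (xorB-involutive s i)) (trans (cong (xorB s) eq) (xorB-involutive s j))

xorB-cancelˡ : ∀ s i j → xorB (xorB s i) (xorB s j) ≡ xorB i j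
xorB-cancelˡ true  true  true  = refl
xorB-cancelˡ true  true  false = refl
xorB-cancelˡ true  false true  = refl
xorB-cancelˡ true  false false = refl
xorB-cancelˡ false true  true  = refl
xorB-cancelˡ false true  false = refl
xorB-cancelˡ false false true  = refl
xorB-cancelˡ false false false = refl

infixr 9 _∘ₚ_

_∘ₚ_ : {A : Set} → Perm A → Perm A → Perm A
σ ∘ₚ τ = ↔-trans τ σ

module _ {A : Set} (π : Perm A) where

  ap-ap⁻¹ : ∀ x → ap π (ap⁻¹ π x) ≡ x
  ap-ap⁻¹ = Inverse.strictlyInverseˡ π

  ap⁻¹-ap : ∀ x → ap⁻¹ π (ap π x) ≡ x
  ap⁻¹-ap = Inverse.strictlyInverseʳ π

to-injective : {A B : Set} (f : A ↔ B) → ∀ {x y} → Inverse.to f x ≡ Inverse.to f y → x ≡ y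
to-injective f = Injection.injective (↔⇒↣ f)

-- Enumerations

-- HasCard _≈_ P k unfolds to Σ (Fin k → T) (IsEnumeration _≈_ P).
record IsEnumeration {I T : Set} (_≈_ : T → T → Set) (P : T → Set) (e : I → T) : Set where
  field
    member     : ∀ i → P (e i)
    injective  : ∀ i j → e i ≈ e j → i ≡ j
    surjective : ∀ t → P t → ∃ λ i → t ≈ e i

isEnumeration : {T : Set} {_≈_ : T → T → Set} {P : T → Set} {k : ℕ} →
                (c : HasCard _≈_ P k) → IsEnumeration _≈_ P (proj₁ c)
isEnumeration (_ , member , injective , surjective) =
  record { member = member ; injective = injective ; surjective = surjective }

module _ {T : Set} {_≈_ : T → T → Set} {P : T → Set} where

  reindex : {I J : Set} {e : I → T} (f : J ↔ I) →
            IsEnumeration _≈_ P e → IsEnumeration _≈_ P (e ∘ Inverse.to f)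
  reindex {e = e} f enum = record
    { member     = member ∘ to
    ; injective  = λ j j′ eq → to-injective f (injective (to j) (to j′) eq)
    ; surjective = λ t Pt →
        let (i , t≈) = surjective t Pt
        in from i , subst (λ i → t ≈ e i) (sym (strictlyInverseˡ i)) t≈
    }
    where
    open IsEnumeration enum
    open Inverse f

  module _ (≈-sym : ∀ {s t} → s ≈ t → t ≈ s) (≈-trans : ∀ {s t u} → s ≈ t → t ≈ u → s ≈ u) where

    enumeration-embedding : {I J : Set} {e : I → T} {e′ : J → T} →
                            IsEnumeration _≈_ P e → IsEnumeration _≈_ P e′ →
                            Σ (I → J) λ f → ∀ {i i′} → f i ≡ f i′ → i ≡ i′
    enumeration-embedding {I} {J} {e} {e′} enum enum′ = f , f-injective
      where
      open IsEnumeration enum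
      open IsEnumeration enum′ using () renaming (surjective to surjective′)
      f : I → J
      f i = proj₁ (surjective′ (e i) (member i))
      f-injective : ∀ {i i′} → f i ≡ f i′ → i ≡ i′
      f-injective {i} {i′} eq = injective i i′ (≈-trans (e≈e′f i)
        (subst (λ j → e′ j ≈ e i′) (sym eq) (≈-sym (e≈e′f i′))))
        where
        e≈e′f : ∀ i → e i ≈ e′ (f i)
        e≈e′f i = proj₂ (surjective′ (e i) (member i))

    enumeration-size-unique : {m n : ℕ} {e : Fin m → T} {e′ : Fin n → T} →
                              IsEnumeration _≈_ P e → IsEnumeration _≈_ P e′ → m ≡ n
    enumeration-size-unique enum enum′ = cantor-schröder-bernstein
      (proj₂ (enumeration-embedding enum enum′)) (proj₂ (enumeration-embedding enum′ enum))

≈ₚ-enumeration-size-unique : {A : Set} {P : Perm A → Set} {m n : ℕ}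
                             {e : Fin m → Perm A} {e′ : Fin n → Perm A} →
                             IsEnumeration _≈ₚ_ P e → IsEnumeration _≈ₚ_ P e′ → m ≡ n
≈ₚ-enumeration-size-unique = enumeration-size-unique
  (λ {σ} {τ} σ≈τ x → sym (σ≈τ x)) (λ {σ} {τ} {ρ} σ≈τ τ≈ρ x → trans (σ≈τ x) (τ≈ρ x))

DedekindFinite : Set → Set
DedekindFinite A = (f : A → A) → (∀ {x y} → f x ≡ f y → x ≡ y) → ∀ y → ∃ λ x → f x ≡ y

fin-dedekindFinite : ∀ n → DedekindFinite (Fin n)
fin-dedekindFinite n f f-injective y with any? (λ x → f x ≟ y)
... | yes hit = hit
... | no  miss = ⊥-elim (1+n≰n (injective⇒≤ {f = f′} f′-injective))
  where
  -- extending f by a value it misses would inject Fin (suc n) into Fin n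
  f′ : Fin (suc n) → Fin n
  f′ zero    = y
  f′ (suc i) = f i
  f′-injective : ∀ {a b} → f′ a ≡ f′ b → a ≡ b
  f′-injective {zero}  {zero}  _  = refl
  f′-injective {zero}  {suc b} eq = ⊥-elim (miss (b , sym eq))
  f′-injective {suc a} {zero}  eq = ⊥-elim (miss (a , eq))
  f′-injective {suc a} {suc b} eq = cong suc (f-injective eq)

-- Automorphisms, cosets and two-fold automorphisms

module _ {V : Set} (Γ : Graph V) where

  IsAut-id : IsAut Γ ↔-refl
  IsAut-id u v = refl

  IsAut-∘ : ∀ {σ τ} → IsAut Γ σ → IsAut Γ τ → IsAut Γ (σ ∘ₚ τ)
  IsAut-∘ aσ aτ u v = trans (aσ _ _) (aτ u v)

  IsAut-⁻¹ : ∀ {σ} → IsAut Γ σ → IsAut Γ (↔-sym σ)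
  IsAut-⁻¹ {σ} aσ u v = trans (sym (aσ _ _)) (cong₂ (adj Γ) (ap-ap⁻¹ σ u) (ap-ap⁻¹ σ v))

  IsAut-cong : ∀ {σ τ} → σ ≈ₚ τ → IsAut Γ σ → IsAut Γ τ
  IsAut-cong eq aσ u v = trans (sym (cong₂ (adj Γ) (eq u) (eq v))) (aσ u v)

  inRightCoset-refl : ∀ π → InRightCoset Γ π π
  inRightCoset-refl π = ↔-refl , IsAut-id , λ _ → refl

  inRightCoset-sym : ∀ {π ρ} → InRightCoset Γ π ρ → InRightCoset Γ ρ π
  inRightCoset-sym {π} {ρ} (σ , aσ , ρ≈σπ) =
    ↔-sym σ , IsAut-⁻¹ {σ} aσ ,
    λ x → trans (sym (ap⁻¹-ap σ (ap π x))) (cong (ap⁻¹ σ) (sym (ρ≈σπ x)))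

  inRightCoset-trans : ∀ {τ π ρ} → InRightCoset Γ π ρ → InRightCoset Γ τ π → InRightCoset Γ τ ρ
  inRightCoset-trans (σ , aσ , ρ≈σπ) (σ′ , aσ′ , π≈σ′τ) =
    σ ∘ₚ σ′ , IsAut-∘ {σ} {σ′} aσ aσ′ , λ x → trans (ρ≈σπ x) (cong (ap σ) (π≈σ′τ x))

  sameRightCoset⇔inRightCoset : ∀ π₁ π₂ → SameRightCoset Γ π₁ π₂ ⇔ InRightCoset Γ π₂ π₁
  sameRightCoset⇔inRightCoset π₁ π₂ = mk⇔
    (λ same → Equivalence.to (same π₁) (inRightCoset-refl π₁))
    (λ π₁∈ ρ → mk⇔ (λ ρ∈ → inRightCoset-trans {π₂} {π₁} {ρ} ρ∈ π₁∈)
                   (λ ρ∈ → inRightCoset-trans {π₁} {π₂} {ρ} ρ∈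
                             (inRightCoset-sym {π₂} {π₁} π₁∈)))

  IsTwoFoldAut : (V → V) → (V → V) → Set
  IsTwoFoldAut f g = ∀ u v → adj Γ (f u) (g v) ≡ adj Γ u v

  twoFold-∘ : ∀ {σ f g} → IsAut Γ σ → IsTwoFoldAut f g → IsTwoFoldAut (ap σ ∘ f) (ap σ ∘ g)
  twoFold-∘ aσ tf u v = trans (aσ _ _) (tf u v)

  twoFold-congʳ : ∀ {f g g′} → g ≗ g′ → IsTwoFoldAut f g → IsTwoFoldAut f g′
  twoFold-congʳ {f} g≗g′ tf u v = trans (cong (adj Γ (f u)) (sym (g≗g′ v))) (tf u v)

  imageNbhdEq⇒adj : ∀ π {v w} → ImageNbhdEq Γ π v w → ∀ y → adj Γ w (ap π y) ≡ adj Γ v y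
  imageNbhdEq⇒adj π {v} {w} im y =
    ⇔→≡ (mk⇔ from-image (λ vy → Equivalence.to (im (ap π y)) (y , vy , refl)))
    where
    from-image : adj Γ w (ap π y) ≡ true → adj Γ v y ≡ true
    from-image wπy with Equivalence.from (im (ap π y)) wπy
    ... | u , vu , πu≡πy = subst (λ z → adj Γ v z ≡ true) (to-injective π πu≡πy) vu

  adj⇒imageNbhdEq : ∀ π {v w} → (∀ y → adj Γ w (ap π y) ≡ adj Γ v y) → ImageNbhdEq Γ π v w
  adj⇒imageNbhdEq π {v} {w} E x = mk⇔
    (λ { (u , vu , πu≡x) → subst (λ z → adj Γ w z ≡ true) πu≡x (trans (E u) vu) })
    (λ wx → ap⁻¹ π x
          , trans (sym (E _)) (subst (λ z → adj Γ w z ≡ true) (sym (ap-ap⁻¹ π x)) wx)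
          , ap-ap⁻¹ π x)

  γ-twoFold : ∀ {π} (h : InAutπ Γ π) → IsTwoFoldAut (γ Γ π h) (ap π)
  γ-twoFold {π} h u = imageNbhdEq⇒adj π (proj₂ (h u))

  twoFold⇒inAutπ : ∀ {f π} → IsTwoFoldAut f (ap π) → InAutπ Γ π
  twoFold⇒inAutπ {f} {π} tf v = f v , adj⇒imageNbhdEq π (tf v)

  inAutπ-aut∘ : ∀ {σ π} → IsAut Γ σ → InAutπ Γ π → InAutπ Γ (σ ∘ₚ π)
  inAutπ-aut∘ {σ} {π} aσ h = twoFold⇒inAutπ {π = σ ∘ₚ π} (twoFold-∘ {σ} aσ (γ-twoFold {π} h))

  coset-enumeration : ∀ {I J : Set} {R : I → Perm V} {e : J → Perm V} →
    IsEnumeration _≈ₚ_ (IsAut Γ) e →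
    (∀ i → InAutπ Γ (R i)) →
    (∀ i i′ → InRightCoset Γ (R i′) (R i) → i ≡ i′) →
    (∀ π → InAutπ Γ π → ∃ λ i → InRightCoset Γ (R i) π) →
    IsEnumeration _≈ₚ_ (InAutπ Γ) (λ p → e (proj₂ p) ∘ₚ R (proj₁ p))
  coset-enumeration {R = R} {e} enum R-inAutπ R-distinct R-covers = record
    { member     = λ { (i , j) → inAutπ-aut∘ {e j} {R i} (member j) (R-inAutπ i) }
    ; injective  = injective′
    ; surjective = surjective′
    }
    where
    open IsEnumeration enum
    injective′ : ∀ p q → (e (proj₂ p) ∘ₚ R (proj₁ p)) ≈ₚ (e (proj₂ q) ∘ₚ R (proj₁ q)) → p ≡ q
    injective′ (i , j) (i′ , j′) eq
      with R-distinct i i′ ( ↔-sym (e j) ∘ₚ e j′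
                           , IsAut-∘ {↔-sym (e j)} {e j′} (IsAut-⁻¹ {e j} (member j)) (member j′)
                           , λ x → trans (sym (ap⁻¹-ap (e j) _)) (cong (ap⁻¹ (e j)) (eq x)))
    ... | refl = cong (i ,_) (injective j j′ λ y →
          trans (cong (ap (e j)) (sym (ap-ap⁻¹ (R i) y)))
                (trans (eq _) (cong (ap (e j′)) (ap-ap⁻¹ (R i) y))))
    surjective′ : ∀ π → InAutπ Γ π → ∃ λ p → π ≈ₚ (e (proj₂ p) ∘ₚ R (proj₁ p))
    surjective′ π h with R-covers π h
    ... | i , σ , aσ , π≈σRi with surjective σ aσ
    ... | j , σ≈ej = (i , j) , λ x → trans (π≈σRi x) (σ≈ej (ap (R i) x))

-- Reduced graphs

module _ {V : Set} (Γ : Graph V) (red : Reduced Γ) where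

  sameAdj⇒≡ : ∀ {a b} → (∀ x → adj Γ a x ≡ adj Γ b x) → a ≡ b
  sameAdj⇒≡ {a} {b} E = red a b λ x → mk⇔ (trans (sym (E x))) (trans (E x))

  twoFold-injectiveˡ : ∀ {f g} → IsTwoFoldAut Γ f g → ∀ {u u′} → f u ≡ f u′ → u ≡ u′
  twoFold-injectiveˡ {f} {g} tf {u} {u′} eq = sameAdj⇒≡ λ y →
    trans (sym (tf u y)) (trans (cong (λ z → adj Γ z (g y)) eq) (tf u′ y))

  twoFold-unique : ∀ {f f′ π} → IsTwoFoldAut Γ f (ap π) → IsTwoFoldAut Γ f′ (ap π) → f ≗ f′
  twoFold-unique {f} {f′} {π} tf tf′ v = sameAdj⇒≡ λ x → begin
    adj Γ (f v) x                      ≡⟨ cong (adj Γ (f v)) (sym (ap-ap⁻¹ π x)) ⟩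
    adj Γ (f v) (ap π (ap⁻¹ π x))      ≡⟨ tf v _ ⟩
    adj Γ v (ap⁻¹ π x)                 ≡⟨ sym (tf′ v _) ⟩
    adj Γ (f′ v) (ap π (ap⁻¹ π x))     ≡⟨ cong (adj Γ (f′ v)) (ap-ap⁻¹ π x) ⟩
    adj Γ (f′ v) x                     ∎

  α-coset-invariant : ∀ {π ρ} → InRightCoset Γ π ρ →
                      (hρ : InAutπ Γ ρ) (hπ : InAutπ Γ π) → α Γ ρ hρ ≗ α Γ π hπ
  α-coset-invariant {π} {ρ} (σ , aσ , ρ≈σπ) hρ hπ v = begin
    ap⁻¹ ρ (γ Γ ρ hρ v)                             ≡⟨ cong (ap⁻¹ ρ) γρ≡σγπ ⟩
    ap⁻¹ ρ (ap σ (γ Γ π hπ v))                      ≡⟨ cong (ap⁻¹ ρ ∘ ap σ) (sym (ap-ap⁻¹ π _)) ⟩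
    ap⁻¹ ρ (ap σ (ap π (α Γ π hπ v)))               ≡⟨ cong (ap⁻¹ ρ) (sym (ρ≈σπ _)) ⟩
    ap⁻¹ ρ (ap ρ (α Γ π hπ v))                      ≡⟨ ap⁻¹-ap ρ _ ⟩
    α Γ π hπ v                                      ∎
    where
    γρ≡σγπ : γ Γ ρ hρ v ≡ ap σ (γ Γ π hπ v)
    γρ≡σγπ = twoFold-unique {π = ρ} (γ-twoFold Γ {ρ} hρ)
      (twoFold-congʳ Γ (λ x → sym (ρ≈σπ x)) (twoFold-∘ Γ {σ} aσ (γ-twoFold Γ {π} hπ))) v

-- The canonical double cover

module _ {V : Set} (Γ : Graph V) where

  flipₚ : Bool → Perm (V × Bool)
  flipₚ s = mk↔ₛ′ flip flip involutive involutive
    where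
    flip : V × Bool → V × Bool
    flip (v , i) = v , xorB s i
    involutive : ∀ p → flip (flip p) ≡ p
    involutive (v , i) = cong (v ,_) (xorB-involutive s i)

  flip-aut : ∀ s → IsAut (B Γ) (flipₚ s)
  flip-aut s (u , i) (v , j) = cong (andB (adj Γ u v)) (xorB-cancelˡ s i j)

  layerwise : (Bool → Perm V) → Perm (V × Bool)
  layerwise F = mk↔ₛ′ (λ { (v , i) → ap (F i) v , i }) (λ { (v , i) → ap⁻¹ (F i) v , i })
    (λ { (v , i) → cong (_, i) (ap-ap⁻¹ (F i) v) })
    (λ { (v , i) → cong (_, i) (ap⁻¹-ap (F i) v) })

  layerwise-cong : ∀ {F G} → (∀ i → F i ≈ₚ G i) → layerwise F ≈ₚ layerwise G
  layerwise-cong F≈G (v , i) = cong (_, i) (F≈G i v)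

  twoFold⇒layerwise-aut : ∀ {F} → IsTwoFoldAut Γ (ap (F false)) (ap (F true)) →
                          IsAut (B Γ) (layerwise F)
  twoFold⇒layerwise-aut tf (u , false) (v , false) = trans (andB-falseʳ _) (sym (andB-falseʳ _))
  twoFold⇒layerwise-aut tf (u , false) (v , true)  = cong (λ a → andB a true) (tf u v)
  twoFold⇒layerwise-aut {F} tf (u , true) (v , false) = cong (λ a → andB a true) (begin
    adj Γ (ap (F true) u) (ap (F false) v)   ≡⟨ adj-sym Γ _ _ ⟩
    adj Γ (ap (F false) v) (ap (F true) u)   ≡⟨ tf v u ⟩
    adj Γ v u                                ≡⟨ adj-sym Γ v u ⟩
    adj Γ u v                                ∎)
  twoFold⇒layerwise-aut tf (u , true) (v , true) = trans (andB-falseʳ _) (sym (andB-falseʳ _))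

  layerwise-aut⇒twoFold : ∀ {F} → IsAut (B Γ) (layerwise F) →
                          IsTwoFoldAut Γ (ap (F false)) (ap (F true))
  layerwise-aut⇒twoFold aut u v =
    trans (sym (andB-trueʳ _)) (trans (aut (u , false) (v , true)) (andB-trueʳ _))

  module _ (φ : Perm (V × Bool)) (s : Bool) (φ-layer : ∀ v i → proj₂ (ap φ (v , i)) ≡ xorB s i) where

    φ-split : ∀ v i → ap φ (v , i) ≡ (proj₁ (ap φ (v , i)) , xorB s i)
    φ-split v i = cong (proj₁ (ap φ (v , i)) ,_) (φ-layer v i)

    layerₚ : Bool → Perm V
    layerₚ i = mk↔ₛ′ (λ v → proj₁ (ap φ (v , i))) (λ y → proj₁ (ap⁻¹ φ (y , xorB s i)))
                     to-from from-to
      where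
      to-from : ∀ y → proj₁ (ap φ (proj₁ (ap⁻¹ φ (y , xorB s i)) , i)) ≡ y
      to-from y = trans (cong (λ j → proj₁ (ap φ (proj₁ p , j))) (sym p-layer)) (cong proj₁ φp≡)
        where
        p : V × Bool
        p = ap⁻¹ φ (y , xorB s i)
        φp≡ : ap φ p ≡ (y , xorB s i)
        φp≡ = ap-ap⁻¹ φ _
        p-layer : proj₂ p ≡ i
        p-layer = xorB-injective s (trans (sym (φ-layer (proj₁ p) (proj₂ p))) (cong proj₂ φp≡))
      from-to : ∀ v → proj₁ (ap⁻¹ φ (proj₁ (ap φ (v , i)) , xorB s i)) ≡ v
      from-to v = trans (cong (proj₁ ∘ ap⁻¹ φ) (sym (φ-split v i))) (cong proj₁ (ap⁻¹-ap φ (v , i)))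

    ≈flip∘layerwise : φ ≈ₚ (flipₚ s ∘ₚ layerwise layerₚ)
    ≈flip∘layerwise (v , i) = φ-split v i

    layerwise-aut : IsAut (B Γ) φ → IsAut (B Γ) (layerwise layerₚ)
    layerwise-aut aφ = IsAut-cong (B Γ) {flipₚ s ∘ₚ φ} {layerwise layerₚ} flip∘φ≈
                         (IsAut-∘ (B Γ) {flipₚ s} {φ} (flip-aut s) aφ)
      where
      flip∘φ≈ : (flipₚ s ∘ₚ φ) ≈ₚ layerwise layerₚ
      flip∘φ≈ (v , i) = trans (cong (ap (flipₚ s)) (φ-split v i))
                              (cong (_ ,_) (xorB-involutive s i))

  module Layers (conn : Connected Γ) (nonbip : NonBipartite Γ)
                {φ : Perm (V × Bool)} (aφ : IsAut (B Γ) φ) where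

    side : V → Bool → Bool
    side v i = proj₂ (ap φ (v , i))

    side-adj : ∀ {u w} → adj Γ u w ≡ true → ∀ i → side w (not i) ≡ not (side u i)
    side-adj {u} {w} uw i = xorB≡true⇒not _ _ (andB≡true⇒ʳ _ _
      (trans (aφ (u , i) (w , not i)) (trans (cong (λ a → andB a (xorB i (not i))) uw) (xorB-not i))))

    sides-equal-along : ∀ {u w} → Walk Γ u w → side u false ≡ side u true → side w false ≡ side w true
    sides-equal-along here eq = eq
    sides-equal-along {u} (step {v = v} uv rest) eq = sides-equal-along rest (begin
      side v false        ≡⟨ side-adj uv true ⟩
      not (side u true)   ≡⟨ cong not (sym eq) ⟩
      not (side u false)  ≡⟨ sym (side-adj uv false) ⟩
      side v true         ∎)

    -- otherwise side · false would 2-colour Γ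
    sides-differ : ∀ v → side v true ≡ not (side v false)
    sides-differ v = ¬-not λ eq → nonbip ((λ w → side w false) , λ u w uw su≡sw →
      not-¬ refl (trans su≡sw (trans (sides-equal-along (conn v w) (sym eq)) (side-adj uw false))))

    side-false-along : ∀ {u w} → Walk Γ u w → side u false ≡ side w false
    side-false-along here = refl
    side-false-along {u} (step {v = v} uv rest) = trans (begin
      side u false              ≡⟨ sym (not-involutive _) ⟩
      not (not (side u false))  ≡⟨ cong not (sym (sides-differ u)) ⟩
      not (side u true)         ≡⟨ sym (side-adj uv true) ⟩
      side v false              ∎) (side-false-along rest)

    side≡xorB : ∀ x v i → side v i ≡ xorB (side x false) i
    side≡xorB x v false = trans (sym (side-false-along (conn x v))) (sym (xorB-falseʳ _))
    side≡xorB x v true  = trans (sides-differ v)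
      (trans (cong not (sym (side-false-along (conn x v)))) (sym (xorB-trueʳ _)))

-- Reduced graphs on a Dedekind-finite vertex set

module _ {V : Set} (Γ : Graph V) (red : Reduced Γ) (fin : DedekindFinite V) where

  γₚ : (π : Perm V) → InAutπ Γ π → Perm V
  γₚ π h = mk↔ₛ′ (γ Γ π h) (λ y → proj₁ (γ-surjective y)) (λ y → proj₂ (γ-surjective y))
                 (λ v → γ-injective (proj₂ (γ-surjective (γ Γ π h v))))
    where
    γ-injective : ∀ {u u′} → γ Γ π h u ≡ γ Γ π h u′ → u ≡ u′
    γ-injective = twoFold-injectiveˡ Γ red {γ Γ π h} {ap π} (γ-twoFold Γ {π} h)
    γ-surjective : ∀ y → ∃ λ v → γ Γ π h v ≡ y
    γ-surjective = fin (γ Γ π h) γ-injective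

  α≗⇒inRightCoset : ∀ {π ρ} (hρ : InAutπ Γ ρ) (hπ : InAutπ Γ π) →
                    α Γ ρ hρ ≗ α Γ π hπ → InRightCoset Γ π ρ
  α≗⇒inRightCoset {π} {ρ} hρ hπ α≗ =
    ρ ∘ₚ ↔-sym π , ρπ⁻¹-aut , λ x → cong (ap ρ) (sym (ap⁻¹-ap π x))
    where
    ρπ⁻¹γπ≡γρ : ∀ v → ap ρ (ap⁻¹ π (γ Γ π hπ v)) ≡ γ Γ ρ hρ v
    ρπ⁻¹γπ≡γρ v = trans (cong (ap ρ) (sym (α≗ v))) (ap-ap⁻¹ ρ _)
    aut-on-γπ : ∀ v z →
                adj Γ (ap ρ (ap⁻¹ π (γ Γ π hπ v))) (ap ρ (ap⁻¹ π z)) ≡ adj Γ (γ Γ π hπ v) z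
    aut-on-γπ v z = begin
      adj Γ (ap ρ (ap⁻¹ π (γ Γ π hπ v))) (ap ρ (ap⁻¹ π z))  ≡⟨ cong (λ a → adj Γ a _) (ρπ⁻¹γπ≡γρ v) ⟩
      adj Γ (γ Γ ρ hρ v) (ap ρ (ap⁻¹ π z))                  ≡⟨ γ-twoFold Γ {ρ} hρ v _ ⟩
      adj Γ v (ap⁻¹ π z)                                    ≡⟨ sym (γ-twoFold Γ {π} hπ v _) ⟩
      adj Γ (γ Γ π hπ v) (ap π (ap⁻¹ π z))                  ≡⟨ cong (adj Γ _) (ap-ap⁻¹ π z) ⟩
      adj Γ (γ Γ π hπ v) z                                  ∎
    ρπ⁻¹-aut : IsAut Γ (ρ ∘ₚ ↔-sym π)
    ρπ⁻¹-aut u z = subst (λ u → adj Γ (ap ρ (ap⁻¹ π u)) (ap ρ (ap⁻¹ π z)) ≡ adj Γ u z)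
                         (ap-ap⁻¹ (γₚ π hπ) u) (aut-on-γπ _ z)

  α≗⇔inRightCoset : ∀ {π ρ} (hρ : InAutπ Γ ρ) (hπ : InAutπ Γ π) →
                    α Γ ρ hρ ≗ α Γ π hπ ⇔ InRightCoset Γ π ρ
  α≗⇔inRightCoset {π} {ρ} hρ hπ =
    mk⇔ (α≗⇒inRightCoset {π} {ρ} hρ hπ) (λ c → α-coset-invariant Γ red {π} {ρ} c hρ hπ)

  imα-representative : ∀ {I : Set} {eC : I → (V → V)} →
                       IsEnumeration _≗_ (InImα Γ) eC → I → Perm V
  imα-representative enumC i = proj₁ (IsEnumeration.member enumC i)

  autπ-enumeration : ∀ {I J : Set} {eC : I → (V → V)} {eA : J → Perm V} →
    (enumC : IsEnumeration _≗_ (InImα Γ) eC) → IsEnumeration _≈ₚ_ (IsAut Γ) eA →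
    IsEnumeration _≈ₚ_ (InAutπ Γ) (λ p → eA (proj₂ p) ∘ₚ imα-representative enumC (proj₁ p))
  autπ-enumeration {I} {eC = eC} {eA} enumC enumA =
    coset-enumeration Γ {R = R} {eA} enumA R-inAutπ R-distinct R-covers
    where
    open IsEnumeration enumC
    R : I → Perm V
    R = imα-representative enumC
    R-inAutπ : ∀ i → InAutπ Γ (R i)
    R-inAutπ i = proj₁ (proj₂ (member i))
    eC≗αR : ∀ i → eC i ≗ α Γ (R i) (R-inAutπ i)
    eC≗αR i = proj₂ (proj₂ (member i))
    R-distinct : ∀ i i′ → InRightCoset Γ (R i′) (R i) → i ≡ i′
    R-distinct i i′ c = injective i i′ λ v →
      trans (eC≗αR i v) (trans (α-coset-invariant Γ red {R i′} {R i} c (R-inAutπ i) (R-inAutπ i′) v)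
                               (sym (eC≗αR i′ v)))
    R-covers : ∀ π → InAutπ Γ π → ∃ λ i → InRightCoset Γ (R i) π
    R-covers π h with surjective (α Γ π h) (π , h , λ _ → refl)
    ... | i , α≗eC =
      i , α≗⇒inRightCoset {R i} {π} h (R-inAutπ i) (λ v → trans (α≗eC v) (eC≗αR i v))

  liftLayers : (π : Perm V) → InAutπ Γ π → Bool → Perm V
  liftLayers π h false = γₚ π h
  liftLayers π h true  = π

  flipLift : ∀ {I : Set} (e : I → Perm V) → (∀ i → InAutπ Γ (e i)) → Bool × I → Perm (V × Bool)
  flipLift e h (s , i) = flipₚ Γ s ∘ₚ layerwise Γ (liftLayers (e i) (h i))

  flipLift-aut : ∀ {I : Set} (e : I → Perm V) (h : ∀ i → InAutπ Γ (e i)) p →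
                 IsAut (B Γ) (flipLift e h p)
  flipLift-aut e h (s , i) =
    IsAut-∘ (B Γ) {flipₚ Γ s} {layerwise Γ (liftLayers (e i) (h i))} (flip-aut Γ s)
      (twoFold⇒layerwise-aut Γ {liftLayers (e i) (h i)} (γ-twoFold Γ {e i} (h i)))

  autB-enumeration : Connected Γ → NonBipartite Γ → V → ∀ {I : Set} {e : I → Perm V} →
    (enum : IsEnumeration _≈ₚ_ (InAutπ Γ) e) →
    IsEnumeration _≈ₚ_ (IsAut (B Γ)) (flipLift e (IsEnumeration.member enum))
  autB-enumeration conn nonbip x {I} {e} enum = record
    { member     = flipLift-aut e member
    ; injective  = λ { (s , i) (s′ , i′) eq → cong₂ _,_
        (trans (sym (xorB-falseʳ s)) (trans (cong proj₂ (eq (x , false))) (xorB-falseʳ s′)))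
        (injective i i′ λ v → cong proj₁ (eq (v , true))) }
    ; surjective = surjective′
    }
    where
    open IsEnumeration enum
    surjective′ : ∀ φ → IsAut (B Γ) φ → ∃ λ p → φ ≈ₚ flipLift e member p
    surjective′ φ aφ = (s , k) , λ p → trans (≈flip∘layerwise Γ φ s φ-layer p)
      (cong (ap (flipₚ Γ s)) (layerwise-cong Γ {L} {liftLayers (e k) (member k)} L≈ p))
      where
      open Layers Γ conn nonbip {φ} aφ
      s : Bool
      s = side x false
      φ-layer : ∀ v i → side v i ≡ xorB s i
      φ-layer = side≡xorB x
      L : Bool → Perm V
      L = layerₚ Γ φ s φ-layer
      L-twoFold : IsTwoFoldAut Γ (ap (L false)) (ap (L true))
      L-twoFold = layerwise-aut⇒twoFold Γ {L} (layerwise-aut Γ φ s φ-layer aφ)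
      L₁-covered : ∃ λ k → L true ≈ₚ e k
      L₁-covered = surjective (L true) (twoFold⇒inAutπ Γ {π = L true} L-twoFold)
      k : I
      k = proj₁ L₁-covered
      L≈ : ∀ i → L i ≈ₚ liftLayers (e k) (member k) i
      L≈ false = twoFold-unique Γ red {π = e k}
        (twoFold-congʳ Γ (proj₂ L₁-covered) L-twoFold) (γ-twoFold Γ {e k} (member k))
      L≈ true  = proj₂ L₁-covered

vertex-of-nonBipartite : ∀ {n} (Γ : Graph (Fin n)) → NonBipartite Γ → Fin n
vertex-of-nonBipartite {zero}  Γ nonbip = ⊥-elim (nonbip ((λ ()) , λ ()))
vertex-of-nonBipartite {suc n} Γ nonbip = zero

2*[c*b]≡c*[2*b] : ∀ c b → 2 * (c * b) ≡ c * (2 * b)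
2*[c*b]≡c*[2*b] c b = begin
  2 * (c * b)  ≡⟨ sym (*-assoc 2 c b) ⟩
  2 * c * b    ≡⟨ cong (_* b) (*-comm 2 c) ⟩
  c * 2 * b    ≡⟨ *-assoc c 2 b ⟩
  c * (2 * b)  ∎

module _ {n : ℕ} (Γ : Graph (Fin n)) (red : Reduced Γ) where

  private
    fin : DedekindFinite (Fin n)
    fin = fin-dedekindFinite n

  α≗⇔sameRightCoset : ∀ {π₁ π₂} (h₁ : InAutπ Γ π₁) (h₂ : InAutπ Γ π₂) →
                      α Γ π₁ h₁ ≗ α Γ π₂ h₂ ⇔ SameRightCoset Γ π₁ π₂
  α≗⇔sameRightCoset {π₁} {π₂} h₁ h₂ =
    ⇔-trans (α≗⇔inRightCoset Γ red fin {π₂} {π₁} h₁ h₂)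
            (⇔-sym (sameRightCoset⇔inRightCoset Γ π₁ π₂))

  |Im[α]|*|Aut|≡|Autπ| : ∀ {a b c} → HasCard _≈ₚ_ (InAutπ Γ) a → HasCard _≈ₚ_ (IsAut Γ) b →
                         HasCard _≗_ (InImα Γ) c → c * b ≡ a
  |Im[α]|*|Aut|≡|Autπ| autπ aut imα = ≈ₚ-enumeration-size-unique
    (reindex *↔× (autπ-enumeration Γ red fin (isEnumeration imα) (isEnumeration aut)))
    (isEnumeration autπ)

  |Aut[BΓ]|≡2*|Autπ| : Connected Γ → NonBipartite Γ → ∀ {b c d} →
                       HasCard _≈ₚ_ (IsAut (B Γ)) d → HasCard _≈ₚ_ (IsAut Γ) b →
                       HasCard _≗_ (InImα Γ) c → d ≡ 2 * (c * b)
  |Aut[BΓ]|≡2*|Autπ| conn nonbip autB aut imα = ≈ₚ-enumeration-size-unique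
    (isEnumeration autB)
    (reindex (↔-trans *↔× (2↔Bool ×-↔ *↔×))
      (autB-enumeration Γ red fin conn nonbip (vertex-of-nonBipartite Γ nonbip)
        (autπ-enumeration Γ red fin (isEnumeration imα) (isEnumeration aut))))

theorem2p5 : (n : ℕ) (Γ : Graph (Fin n)) → Reduced Γ →
    ((π₁ π₂ : Perm (Fin n)) (h₁ : InAutπ Γ π₁) (h₂ : InAutπ Γ π₂) →
      (∀ v → α Γ π₁ h₁ v ≡ α Γ π₂ h₂ v) ⇔ SameRightCoset Γ π₁ π₂)
    × (∀ a b c →
        HasCard _≈ₚ_ (InAutπ Γ) a →
        HasCard _≈ₚ_ (IsAut Γ) b →
        HasCard (λ f g → ∀ v → f v ≡ g v) (InImα Γ) c →
        c * b ≡ a)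
    × (Connected Γ → NonBipartite Γ → ∀ b c d →
        HasCard _≈ₚ_ (IsAut (B Γ)) d →
        HasCard _≈ₚ_ (IsAut Γ) b →
        HasCard (λ f g → ∀ v → f v ≡ g v) (InImα Γ) c →
        d ≡ c * (2 * b))
theorem2p5 n Γ red =
    (λ π₁ π₂ → α≗⇔sameRightCoset Γ red {π₁} {π₂})
  , (λ a b c → |Im[α]|*|Aut|≡|Autπ| Γ red)
  , λ conn nonbip b c d autB aut imα →
      trans (|Aut[BΓ]|≡2*|Autπ| Γ red conn nonbip autB aut imα) (2*[c*b]≡c*[2*b] c b)
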